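{- Let $p$ be an odd prime and let $G$ be a finite $p$-group with a normal cyclic subgroup $N=\langle a\rangle$ and an element $b$ such that $G=N\rtimes\langle b\rangle$ (i.e. $G=N\langle b\rangle$ and $N\cap\langle b\rangle=1$), where $o(a)=p^s\geq p$ and $o(b)=p^t\geq p$. Then every element of order $p$ in $G$ lies in the subgroup $\langle a^{p^{s-1}}\rangle\times\langle b^{p^{t-1}}\rangle$. -}

module Defs where

open import Level using (Level)
open import Algebra.Bundles using (Group)
open import Data.Nat using (ℕ; zero; suc; _<_)
open import Data.Product using (∃; ∃₂; _×_)
open import Relation.Nullary using (¬_)

module _ {c ℓ : Level} (G : Group c ℓ) where
  open Group G

  pow : Carrier → ℕ → Carrier
  pow g zero    = ε
  pow g (suc n) = g ∙ pow g n

  -- x ∈ ⟨ g ⟩  (for elements of finite order, the cyclic subgroup is the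
  -- set of non-negative powers)
  InCyclic : Carrier → Carrier → Set ℓ
  InCyclic g x = ∃ λ k → x ≈ pow g k

  InProduct : Carrier → Carrier → Carrier → Set ℓ
  InProduct g h x = ∃₂ λ i j → x ≈ pow g i ∙ pow h j

  HasOrder : Carrier → ℕ → Set ℓ
  HasOrder g n = (0 < n) × (pow g n ≈ ε) × (∀ k → 0 < k → k < n → ¬ (pow g k ≈ ε))

module Submission where

-- Write x = aⁱbʲ and let b act on ⟨a⟩ by a ↦ aʳ, so that c = bʲ acts by a ↦ a^ρ with ρ = rʲ.
-- Then xᵖ = a^(i (1 + ρ + ⋯ + ρ^(p−1))) cᵖ, and since ⟨a⟩ ∩ ⟨b⟩ = 1 both factors are trivial.
-- From cᵖ = b^(pj) = 1 we get p^(t−1) ∣ j.  As cᵖ acts trivially on ⟨a⟩, ρᵖ ≡ 1 (mod pˢ), hence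
-- ρ ≡ 1 (mod p) by Fermat's little theorem.  For odd p and ρ ≡ 1 (mod p) the geometric sum
-- 1 + ρ + ⋯ + ρ^(p−1) is p times a number prime to p, so pˢ ∣ i (1 + ρ + ⋯ + ρ^(p−1)) gives p^(s−1) ∣ i.

open import Defs
open import Level using (Level; _⊔_)
open import Algebra.Bundles using (Group)
open import Data.Nat using (ℕ; _≤_; _^_; _∸_)
open import Data.Nat.Primality using (Prime)
open import Relation.Binary.PropositionalEquality using (_≢_)
open import Data.Product using (_×_)

open import Data.Nat hiding (_⊔_)
open import Data.Nat.Properties
open import Data.Nat.Divisibility
open import Data.Nat.DivMod
open import Data.Nat.Primality
open import Data.Nat.Combinatorics using (_C_; nCn≡1; k![n∸k]!∣n!)
open import Data.Nat.Combinatorics.Specification using (nCk≡n!/k![n-k]!)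
open import Data.Nat.Tactic.RingSolver using (solve-∀)
open import Data.Fin.Base using (Fin; toℕ; fromℕ; inject₁) renaming (zero to fzero; suc to fsuc)
open import Data.Fin.Properties using (toℕ-fromℕ; toℕ-inject₁; toℕ<n)
open import Data.Product using (∃; _,_; proj₁; proj₂)
open import Data.Sum using (inj₁; inj₂; [_,_]′)
open import Data.Empty using (⊥-elim)
open import Function using (_∘_; id)
open import Relation.Binary.PropositionalEquality as ≡ using (_≡_; refl; cong; cong₂; subst; module ≡-Reasoning)
import Algebra.Properties.CommutativeSemiring.Binomial as Binomial
import Algebra.Properties.Group as GroupProperties
import Algebra.Properties.Monoid.Mult as MonoidMult
import Algebra.Properties.Monoid.Sum as MonoidSum
import Algebra.Properties.Semiring.Exp as SemiringExp
import Algebra.Properties.Semiring.Mult as SemiringMult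

prime>1 : ∀ {p} → Prime p → 1 < p
prime>1 {p} p-prime = nonTrivial⇒n>1 p {{prime⇒nonTrivial p-prime}}

prime∤m! : ∀ {p m} → Prime p → m < p → p ∤ m !
prime∤m! {m = zero}  p-prime _   p∣1 = <⇒≱ (prime>1 p-prime) (∣⇒≤ p∣1)
prime∤m! {m = suc m} p-prime m<p p∣m! with euclidsLemma (suc m) (m !) p-prime p∣m!
... | inj₁ p∣1+m = <⇒≱ m<p (∣⇒≤ p∣1+m)
... | inj₂ p∣m!  = prime∤m! p-prime (<-trans (n<1+n m) m<p) p∣m!

prime∣pCk : ∀ {p k} → Prime p → 0 < k → k < p → p ∣ p C k
prime∣pCk {p@(suc q)} {k} p-prime 0<k k<p =
  [ id , ⊥-elim ∘ p∤k!*[p∸k]! ]′ (euclidsLemma (p C k) (k ! * (p ∸ k) !) p-prime p∣pCk*k!*[p∸k]!)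
  where
  instance _ = k !* (p ∸ k) !≢0
  p∣pCk*k!*[p∸k]! : p ∣ (p C k) * (k ! * (p ∸ k) !)
  p∣pCk*k!*[p∸k]! = ∣-trans (m∣m*n (q !))
    (m/n∣o⇒m∣o*n (k![n∸k]!∣n! (<⇒≤ k<p)) (∣-reflexive (≡.sym (nCk≡n!/k![n-k]! (<⇒≤ k<p)))))
  p∤k!*[p∸k]! : p ∤ k ! * (p ∸ k) !
  p∤k!*[p∸k]! = [ prime∤m! p-prime k<p , prime∤m! p-prime (∸-monoʳ-< 0<k (<⇒≤ k<p)) ]′
              ∘ euclidsLemma (k !) ((p ∸ k) !) p-prime

-- The library's binomial theorem is phrased with the generic semiring operations _×_ and _^_,
-- which agree with those of ℕ only propositionally.
module ℕ-Binomial = Binomial +-*-commutativeSemiring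
open MonoidSum +-0-monoid using (sum; sum-init-last)
open SemiringExp +-*-semiring using () renaming (_^_ to _^ₛ_)
open SemiringMult +-*-semiring using () renaming (_×_ to _×ₛ_)

^ₛ≡^ : ∀ x n → x ^ₛ n ≡ x ^ n
^ₛ≡^ x zero    = refl
^ₛ≡^ x (suc n) = cong (x *_) (^ₛ≡^ x n)

×ₛ≡* : ∀ n x → n ×ₛ x ≡ n * x
×ₛ≡* zero    x = refl
×ₛ≡* (suc n) x = cong (x +_) (×ₛ≡* n x)

∣-sum : ∀ {d n} (f : Fin n → ℕ) → (∀ i → d ∣ f i) → d ∣ sum f
∣-sum {n = zero}  f d∣f = _ ∣0
∣-sum {n = suc n} f d∣f = ∣m∣n⇒∣m+n (d∣f fzero) (∣-sum (f ∘ fsuc) (d∣f ∘ fsuc))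

binomialTerm[x,1] : ∀ x n (k : Fin (suc n)) → ℕ-Binomial.binomialTerm x 1 n k ≡ (n C toℕ k) * x ^ toℕ k
binomialTerm[x,1] x n k = begin
  (n C i) ×ₛ (x ^ₛ i * 1 ^ₛ (n ∸ i)) ≡⟨ ×ₛ≡* (n C i) _ ⟩
  (n C i) * (x ^ₛ i * 1 ^ₛ (n ∸ i))  ≡⟨ cong₂ (λ u v → (n C i) * (u * v)) (^ₛ≡^ x i) 1^ₛ[n∸i]≡1 ⟩
  (n C i) * (x ^ i * 1)               ≡⟨ cong ((n C i) *_) (*-identityʳ (x ^ i)) ⟩
  (n C i) * x ^ i                     ∎
  where
  open ≡-Reasoning
  i : ℕ
  i = toℕ k
  1^ₛ[n∸i]≡1 : 1 ^ₛ (n ∸ i) ≡ 1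
  1^ₛ[n∸i]≡1 = ≡.trans (^ₛ≡^ 1 (n ∸ i)) (^-zeroˡ (n ∸ i))

[x+1]^p%p≡[1+x^p]%p : ∀ {p} .{{_ : NonZero p}} → Prime p → ∀ x → (x + 1) ^ p % p ≡ (1 + x ^ p) % p
[x+1]^p%p≡[1+x^p]%p {p@(suc q)} p-prime x = begin
  (x + 1) ^ p % p                       ≡⟨ cong (_% p) expansion ⟩
  ((1 + x ^ p) + M) % p                 ≡⟨ cong (λ m → ((1 + x ^ p) + m) % p) (m∣n⇒n≡quotient*m p∣M) ⟩
  ((1 + x ^ p) + quotient p∣M * p) % p  ≡⟨ [m+kn]%n≡m%n (1 + x ^ p) (quotient p∣M) p ⟩
  (1 + x ^ p) % p                       ∎
  where
  open ≡-Reasoning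
  term : Fin (suc p) → ℕ
  term = ℕ-Binomial.binomialTerm x 1 p
  M : ℕ
  M = sum (λ i → term (fsuc (inject₁ i)))
  p∣M : p ∣ M
  p∣M = ∣-sum _ λ i → subst (p ∣_) (≡.sym (binomialTerm[x,1] x p (fsuc (inject₁ i))))
    (∣m⇒∣m*n _ (prime∣pCk p-prime z<s (s<s (subst (_< q) (≡.sym (toℕ-inject₁ i)) (toℕ<n i)))))
  first : term fzero ≡ 1
  first = binomialTerm[x,1] x p fzero
  last : term (fromℕ p) ≡ x ^ p
  last = begin
    term (fromℕ p)                     ≡⟨ binomialTerm[x,1] x p (fromℕ p) ⟩
    (p C toℕ (fromℕ p)) * x ^ toℕ (fromℕ p) ≡⟨ cong (λ i → (p C i) * x ^ i) (toℕ-fromℕ p) ⟩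
    (p C p) * x ^ p                    ≡⟨ cong (_* x ^ p) (nCn≡1 p) ⟩
    1 * x ^ p                          ≡⟨ *-identityˡ (x ^ p) ⟩
    x ^ p                              ∎
  expansion : (x + 1) ^ p ≡ (1 + x ^ p) + M
  expansion = begin
    (x + 1) ^ p                   ≡⟨ ≡.sym (^ₛ≡^ (x + 1) p) ⟩
    (x + 1) ^ₛ p                  ≡⟨ ℕ-Binomial.theorem p x 1 ⟩
    term fzero + sum (term ∘ fsuc) ≡⟨ cong (term fzero +_) (sum-init-last (term ∘ fsuc)) ⟩
    term fzero + (M + term (fromℕ p)) ≡⟨ cong₂ (λ u v → u + (M + v)) first last ⟩
    1 + (M + x ^ p)               ≡⟨ cong (1 +_) (+-comm M (x ^ p)) ⟩
    1 + (x ^ p + M)               ≡⟨ ≡.sym (+-assoc 1 (x ^ p) M) ⟩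
    (1 + x ^ p) + M               ∎

fermat : ∀ {p} .{{_ : NonZero p}} → Prime p → ∀ x → x ^ p % p ≡ x % p
fermat {suc q} p-prime zero    = refl
fermat {p}     p-prime (suc x) = begin
  suc x ^ p % p                 ≡⟨ cong (λ y → y ^ p % p) (+-comm 1 x) ⟩
  (x + 1) ^ p % p               ≡⟨ [x+1]^p%p≡[1+x^p]%p p-prime x ⟩
  (1 + x ^ p) % p               ≡⟨ %-distribˡ-+ 1 (x ^ p) p ⟩
  (1 % p + x ^ p % p) % p       ≡⟨ cong (λ y → (1 % p + y) % p) (fermat p-prime x) ⟩
  (1 % p + x % p) % p           ≡⟨ %-distribˡ-+ 1 x p ⟨
  suc x % p                     ∎
  where open ≡-Reasoning

geometricSum : ℕ → ℕ → ℕ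
geometricSum r zero    = 0
geometricSum r (suc n) = 1 + r * geometricSum r n

triangular : ℕ → ℕ
triangular zero    = 0
triangular (suc n) = n + triangular n

geometricSum[1+up] : ∀ u p n → ∃ λ w → geometricSum (1 + u * p) n ≡ n + u * p * triangular n + p * p * w
geometricSum[1+up] u p zero    = 0 , base u p
  where
  base : ∀ u p → 0 ≡ 0 + u * p * 0 + p * p * 0
  base = solve-∀
geometricSum[1+up] u p (suc n) with geometricSum[1+up] u p n
... | w , eq = w + u * u * triangular n + u * p * w ,
  ≡.trans (cong (λ g → 1 + (1 + u * p) * g) eq) (step u p n (triangular n) w)
  where
  step : ∀ u p n t w → 1 + (1 + u * p) * (n + u * p * t + p * p * w)
                     ≡ suc n + u * p * (n + t) + p * p * (w + u * u * t + u * p * w)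
  step = solve-∀

triangular[1+2q] : ∀ q → triangular (suc (q * 2)) ≡ suc (q * 2) * q
triangular[1+2q] zero    = refl
triangular[1+2q] (suc q) =
  ≡.trans (cong (λ t → suc (suc (q * 2)) + (suc (q * 2) + t)) (triangular[1+2q] q)) (step q)
  where
  step : ∀ q → suc (suc (q * 2)) + (suc (q * 2) + suc (q * 2) * q) ≡ suc (suc (suc (q * 2))) * suc q
  step = solve-∀

prime≢2⇒odd : ∀ {p} → Prime p → p ≢ 2 → ∃ λ q → p ≡ suc (q * 2)
prime≢2⇒odd {p} p-prime p≢2 with p % 2 | m≡m%n+[m/n]*n p 2 | m%n<n p 2
... | 1           | p≡1+[p/2]*2 | _ = p / 2 , p≡1+[p/2]*2
... | suc (suc _) | _           | s<s (s<s ())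
... | zero        | p≡[p/2]*2   | _ = ⊥-elim (prime⇒¬composite p-prime (composite 2<p (divides (p / 2) p≡[p/2]*2)))
  where
  2<p : 2 < p
  2<p = ≤∧≢⇒< (prime>1 p-prime) (p≢2 ∘ ≡.sym)

-- The linear term u p · p (p ∸ 1) / 2 is divisible by p² because p is odd.
geometricSum[1+up,p] : ∀ {p} → Prime p → p ≢ 2 → ∀ u → ∃ λ m → geometricSum (1 + u * p) p ≡ p * (1 + p * m)
geometricSum[1+up,p] {p} p-prime p≢2 u with prime≢2⇒odd p-prime p≢2
... | q , p≡1+2q with geometricSum[1+up] u p p
...   | w , eq = u * q + w , (begin
  geometricSum (1 + u * p) p                ≡⟨ eq ⟩
  p + u * p * triangular p + p * p * w      ≡⟨ cong (λ t → p + u * p * t + p * p * w) triangular[p] ⟩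
  p + u * p * (p * q) + p * p * w           ≡⟨ factor p u q w ⟩
  p * (1 + p * (u * q + w))                 ∎)
  where
  open ≡-Reasoning
  factor : ∀ p u q w → p + u * p * (p * q) + p * p * w ≡ p * (1 + p * (u * q + w))
  factor = solve-∀
  triangular[p] : triangular p ≡ p * q
  triangular[p] =
    ≡.trans (cong triangular p≡1+2q) (≡.trans (triangular[1+2q] q) (cong (_* q) (≡.sym p≡1+2q)))

p^k∣m*n⇒p^k∣m : ∀ {p n} → Prime p → p ∤ n → ∀ k m → p ^ k ∣ m * n → p ^ k ∣ m
p^k∣m*n⇒p^k∣m p-prime p∤n zero m _ = 1∣ m
p^k∣m*n⇒p^k∣m {p} {n} p-prime p∤n (suc k) m p^[1+k]∣m*n
  with euclidsLemma m n p-prime (∣-trans (m∣m*n (p ^ k)) p^[1+k]∣m*n)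
... | inj₂ p∣n = ⊥-elim (p∤n p∣n)
... | inj₁ (divides m′ refl) =
  subst (p ^ suc k ∣_) (*-comm p m′)
    (*-monoʳ-∣ p (p^k∣m*n⇒p^k∣m p-prime p∤n k m′ (*-cancelˡ-∣ p p^[1+k]∣p*[m′*n])))
  where
  instance _ = prime⇒nonZero p-prime
  p^[1+k]∣p*[m′*n] : p ^ suc k ∣ p * (m′ * n)
  p^[1+k]∣p*[m′*n] = subst (p ^ suc k ∣_) (reassoc m′ p n) p^[1+k]∣m*n
    where
    reassoc : ∀ m′ p n → m′ * p * n ≡ p * (m′ * n)
    reassoc = solve-∀

prime∤1+p*m : ∀ {p} → Prime p → ∀ m → p ∤ 1 + p * m
prime∤1+p*m {p} p-prime m p∣1+pm =
  <⇒≱ (prime>1 p-prime) (∣⇒≤ (∣m+n∣m⇒∣n (subst (p ∣_) (+-comm 1 (p * m)) p∣1+pm) (m∣m*n m)))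

p^[1+k]∣m*geometricSum⇒p^k∣m : ∀ {p r} → Prime p → p ≢ 2 → (∃ λ u → r ≡ 1 + u * p) →
  ∀ k m → p ^ suc k ∣ m * geometricSum r p → p ^ k ∣ m
p^[1+k]∣m*geometricSum⇒p^k∣m {p} p-prime p≢2 (u , refl) k m p^[1+k]∣m*S
  with geometricSum[1+up,p] p-prime p≢2 u
... | w , S≡p*[1+pw] = p^k∣m*n⇒p^k∣m p-prime (prime∤1+p*m p-prime w) k m
  (*-cancelˡ-∣ p (subst (p ^ suc k ∣_) (≡.trans (cong (m *_) S≡p*[1+pw]) (reassoc m p (1 + p * w))) p^[1+k]∣m*S))
  where
  instance _ = prime⇒nonZero p-prime
  reassoc : ∀ m p n → m * (p * n) ≡ p * (m * n)
  reassoc = solve-∀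

r^p≡1[p^[1+s]]⇒r≡1[p] : ∀ {p} → Prime p → ∀ s r q → r ^ p ≡ 1 + q * p ^ suc s → ∃ λ u → r ≡ 1 + u * p
r^p≡1[p^[1+s]]⇒r≡1[p] {p} p-prime s r q r^p≡1+q*p^[1+s] =
  r / p , ≡.trans (m≡m%n+[m/n]*n r p) (cong (_+ r / p * p) r%p≡1)
  where
  open ≡-Reasoning
  instance _ = prime⇒nonZero p-prime
  r%p≡1 : r % p ≡ 1
  r%p≡1 = begin
    r % p                         ≡⟨ fermat p-prime r ⟨
    r ^ p % p                     ≡⟨ cong (_% p) r^p≡1+q*p^[1+s] ⟩
    (1 + q * (p * p ^ s)) % p     ≡⟨ cong (λ n → (1 + n) % p) (reassoc q p (p ^ s)) ⟩
    (1 + q * p ^ s * p) % p       ≡⟨ [m+kn]%n≡m%n 1 (q * p ^ s) p ⟩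
    1 % p                         ≡⟨ m<n⇒m%n≡m (prime>1 p-prime) ⟩
    1                             ∎
    where
    reassoc : ∀ q p m → q * (p * m) ≡ q * m * p
    reassoc = solve-∀

module _ {c ℓ : Level} (G : Group c ℓ) where
  open Group G renaming (refl to ≈-refl)
  open GroupProperties G using (inverseʳ-unique; identityˡ-unique; identityʳ-unique)
  open MonoidMult monoid using (×-congʳ; ×-homo-+; ×-assocˡ) renaming (_×_ to _×ᴹ_)
  open import Relation.Binary.Reasoning.Setoid setoid

  pow≡× : ∀ g n → pow G g n ≡ n ×ᴹ g
  pow≡× g zero    = refl
  pow≡× g (suc n) = cong (g ∙_) (pow≡× g n)

  pow-cong : ∀ n {g h} → g ≈ h → pow G g n ≈ pow G h n
  pow-cong n {g} {h} rewrite pow≡× g n | pow≡× h n = ×-congʳ n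

  pow-+ : ∀ g m n → pow G g (m + n) ≈ pow G g m ∙ pow G g n
  pow-+ g m n rewrite pow≡× g (m + n) | pow≡× g m | pow≡× g n = ×-homo-+ g m n

  pow-* : ∀ g m n → pow G g (m * n) ≈ pow G (pow G g n) m
  pow-* g m n rewrite pow≡× g (m * n) | pow≡× (pow G g n) m | pow≡× g n = sym (×-assocˡ g m n)

  pow-ε : ∀ n → pow G ε n ≈ ε
  pow-ε zero    = ≈-refl
  pow-ε (suc n) = trans (identityˡ _) (pow-ε n)

  pow-*-≈ε : ∀ {g n} → pow G g n ≈ ε → ∀ q → pow G g (q * n) ≈ ε
  pow-*-≈ε {g} {n} gⁿ≈ε q = trans (pow-* g q n) (trans (pow-cong q gⁿ≈ε) (pow-ε q))

  hasOrder⇒∣ : ∀ {g n k} → HasOrder G g n → pow G g k ≈ ε → n ∣ k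
  hasOrder⇒∣ {g} {n} {k} (0<n , gⁿ≈ε , minimal) gᵏ≈ε = m%n≡0⇒n∣m k n k%n≡0
    where
    instance _ = >-nonZero 0<n
    g^[k%n]≈ε : pow G g (k % n) ≈ ε
    g^[k%n]≈ε = begin
      pow G g (k % n)                        ≈⟨ identityʳ _ ⟨
      pow G g (k % n) ∙ ε                    ≈⟨ ∙-congˡ (pow-*-≈ε gⁿ≈ε (k / n)) ⟨
      pow G g (k % n) ∙ pow G g (k / n * n)  ≈⟨ pow-+ g (k % n) (k / n * n) ⟨
      pow G g (k % n + k / n * n)            ≡⟨ cong (pow G g) (m≡m%n+[m/n]*n k n) ⟨
      pow G g k                              ≈⟨ gᵏ≈ε ⟩
      ε                                      ∎
    k%n≡0 : k % n ≡ 0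
    k%n≡0 with k % n | g^[k%n]≈ε | m%n<n k n
    ... | zero  | _         | _     = refl
    ... | suc r | g^[1+r]≈ε | 1+r<n = ⊥-elim (minimal (suc r) z<s 1+r<n g^[1+r]≈ε)

  pow≈self⇒≡1+q*n : ∀ {g n k} → HasOrder G g n → 1 < n → pow G g k ≈ g → ∃ λ q → k ≡ 1 + q * n
  pow≈self⇒≡1+q*n {g} {k = zero} g-order 1<n ε≈g =
    ⊥-elim (proj₂ (proj₂ g-order) 1 z<s 1<n (trans (identityʳ g) (sym ε≈g)))
  pow≈self⇒≡1+q*n {g} {k = suc e} g-order 1<n g^[1+e]≈g
    with hasOrder⇒∣ {k = e} g-order (identityʳ-unique g (pow G g e) g^[1+e]≈g)
  ... | divides q refl = q , refl

  record ActsByPower (h a : Carrier) (r : ℕ) : Set ℓ where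
    constructor actsByPower
    field
      swap : h ∙ a ≈ pow G a r ∙ h

  normal⇒actsByPower : ∀ {g a} → InCyclic G a ((g ∙ a) ∙ g ⁻¹) → ∃ λ r → ActsByPower g a r
  normal⇒actsByPower {g} {a} (r , gag⁻¹≈aʳ) = r , actsByPower (begin
    g ∙ a                 ≈⟨ identityʳ _ ⟨
    (g ∙ a) ∙ ε           ≈⟨ ∙-congˡ (inverseˡ g) ⟨
    (g ∙ a) ∙ (g ⁻¹ ∙ g)  ≈⟨ assoc _ _ _ ⟨
    ((g ∙ a) ∙ g ⁻¹) ∙ g  ≈⟨ ∙-congʳ gag⁻¹≈aʳ ⟩
    pow G a r ∙ g         ∎)

  actsByPower-pow : ∀ {h a r} → ActsByPower h a r → ∀ k → h ∙ pow G a k ≈ pow G a (k * r) ∙ h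
  actsByPower-pow {h} {a} {r} h-acts zero    = trans (identityʳ h) (sym (identityˡ h))
  actsByPower-pow {h} {a} {r} h-acts (suc k) = begin
    h ∙ (a ∙ pow G a k)                      ≈⟨ assoc _ _ _ ⟨
    (h ∙ a) ∙ pow G a k                      ≈⟨ ∙-congʳ (ActsByPower.swap h-acts) ⟩
    (pow G a r ∙ h) ∙ pow G a k              ≈⟨ assoc _ _ _ ⟩
    pow G a r ∙ (h ∙ pow G a k)              ≈⟨ ∙-congˡ (actsByPower-pow h-acts k) ⟩
    pow G a r ∙ (pow G a (k * r) ∙ h)        ≈⟨ assoc _ _ _ ⟨
    (pow G a r ∙ pow G a (k * r)) ∙ h        ≈⟨ ∙-congʳ (pow-+ a r (k * r)) ⟨
    pow G a (r + k * r) ∙ h                  ∎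

  actsByPower-iterate : ∀ {h a r} → ActsByPower h a r → ∀ n → ActsByPower (pow G h n) a (r ^ n)
  actsByPower-iterate {h} {a} {r} h-acts zero    =
    actsByPower (trans (identityˡ a) (sym (trans (identityʳ _) (identityʳ a))))
  actsByPower-iterate {h} {a} {r} h-acts (suc n) = actsByPower (begin
    (h ∙ pow G h n) ∙ a                      ≈⟨ assoc _ _ _ ⟩
    h ∙ (pow G h n ∙ a)                      ≈⟨ ∙-congˡ (ActsByPower.swap (actsByPower-iterate h-acts n)) ⟩
    h ∙ (pow G a (r ^ n) ∙ pow G h n)        ≈⟨ assoc _ _ _ ⟨
    (h ∙ pow G a (r ^ n)) ∙ pow G h n        ≈⟨ ∙-congʳ (actsByPower-pow h-acts (r ^ n)) ⟩
    (pow G a (r ^ n * r) ∙ h) ∙ pow G h n    ≈⟨ assoc _ _ _ ⟩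
    pow G a (r ^ n * r) ∙ (h ∙ pow G h n)    ≡⟨ cong (λ k → pow G a k ∙ (h ∙ pow G h n)) (*-comm (r ^ n) r) ⟩
    pow G a (r * r ^ n) ∙ (h ∙ pow G h n)    ∎)

  actsByPower-trivial : ∀ {h a r} → ActsByPower h a r → h ≈ ε → pow G a r ≈ a
  actsByPower-trivial {h} {a} {r} (actsByPower h∙a≈aʳ∙h) h≈ε = begin
    pow G a r       ≈⟨ identityʳ _ ⟨
    pow G a r ∙ ε   ≈⟨ ∙-congˡ h≈ε ⟨
    pow G a r ∙ h   ≈⟨ h∙a≈aʳ∙h ⟨
    h ∙ a           ≈⟨ ∙-congʳ h≈ε ⟩
    ε ∙ a           ≈⟨ identityˡ a ⟩
    a               ∎

  pow-[aⁱh]ⁿ : ∀ {h a ρ} → ActsByPower h a ρ →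
    ∀ i n → pow G (pow G a i ∙ h) n ≈ pow G a (i * geometricSum ρ n) ∙ pow G h n
  pow-[aⁱh]ⁿ {a = a} h-acts i zero    = sym (trans (identityʳ _) (reflexive (cong (pow G a) (*-zeroʳ i))))
  pow-[aⁱh]ⁿ {h} {a} {ρ} h-acts i (suc n) = begin
    (pow G a i ∙ h) ∙ pow G (pow G a i ∙ h) n          ≈⟨ ∙-congˡ (pow-[aⁱh]ⁿ h-acts i n) ⟩
    (pow G a i ∙ h) ∙ (pow G a (i * S) ∙ pow G h n)    ≈⟨ assoc _ _ _ ⟩
    pow G a i ∙ (h ∙ (pow G a (i * S) ∙ pow G h n))    ≈⟨ ∙-congˡ (assoc _ _ _) ⟨
    pow G a i ∙ ((h ∙ pow G a (i * S)) ∙ pow G h n)    ≈⟨ ∙-congˡ (∙-congʳ (actsByPower-pow h-acts (i * S))) ⟩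
    pow G a i ∙ ((pow G a (i * S * ρ) ∙ h) ∙ pow G h n) ≈⟨ ∙-congˡ (assoc _ _ _) ⟩
    pow G a i ∙ (pow G a (i * S * ρ) ∙ (h ∙ pow G h n)) ≈⟨ assoc _ _ _ ⟨
    (pow G a i ∙ pow G a (i * S * ρ)) ∙ (h ∙ pow G h n) ≈⟨ ∙-congʳ (pow-+ a i (i * S * ρ)) ⟨
    pow G a (i + i * S * ρ) ∙ (h ∙ pow G h n)          ≡⟨ cong (λ k → pow G a k ∙ (h ∙ pow G h n)) (distrib i ρ S) ⟨
    pow G a (i * (1 + ρ * S)) ∙ (h ∙ pow G h n)        ∎
    where
    S : ℕ
    S = geometricSum ρ n
    distrib : ∀ i ρ S → i * (1 + ρ * S) ≡ i + i * S * ρ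
    distrib = solve-∀

  InCyclic-⁻¹ : ∀ {g n x} → HasOrder G g n → InCyclic G g x → InCyclic G g (x ⁻¹)
  InCyclic-⁻¹ {g} {suc n} {x} (z<s , g^[1+n]≈ε , _) (k , x≈gᵏ) =
    k * n , sym (inverseʳ-unique x _ (begin
    x ∙ pow G g (k * n)           ≈⟨ ∙-congʳ x≈gᵏ ⟩
    pow G g k ∙ pow G g (k * n)   ≈⟨ pow-+ g k (k * n) ⟨
    pow G g (k + k * n)           ≡⟨ cong (pow G g) (*-suc k n) ⟨
    pow G g (k * suc n)           ≈⟨ pow-*-≈ε g^[1+n]≈ε k ⟩
    ε                             ∎))

  TrivialIntersection : Carrier → Carrier → Set (c ⊔ ℓ)
  TrivialIntersection a b = ∀ x → InCyclic G a x → InCyclic G b x → x ≈ ε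

  trivialIntersection-∙≈ε : ∀ {a b n u v} → TrivialIntersection a b → HasOrder G a n →
    InCyclic G a u → InCyclic G b v → u ∙ v ≈ ε → u ≈ ε × v ≈ ε
  trivialIntersection-∙≈ε {a} {u = u} {v} ⟨a⟩∩⟨b⟩≈1 a-order u∈⟨a⟩ v∈⟨b⟩ u∙v≈ε =
    identityˡ-unique u v (trans u∙v≈ε (sym v≈ε)) , v≈ε
    where
    v≈u⁻¹ : v ≈ u ⁻¹
    v≈u⁻¹ = inverseʳ-unique u v u∙v≈ε
    v∈⟨a⟩ : InCyclic G a v
    v∈⟨a⟩ with InCyclic-⁻¹ a-order u∈⟨a⟩
    ... | k , u⁻¹≈aᵏ = k , trans v≈u⁻¹ u⁻¹≈aᵏ
    v≈ε : v ≈ ε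
    v≈ε = ⟨a⟩∩⟨b⟩≈1 v v∈⟨a⟩ v∈⟨b⟩

  [aⁱbʲ]ⁿ≈ε⇒factors≈ε : ∀ {a b ρ m x} i j n → TrivialIntersection a b → HasOrder G a m →
    ActsByPower (pow G b j) a ρ → x ≈ pow G a i ∙ pow G b j → pow G x n ≈ ε →
    pow G a (i * geometricSum ρ n) ≈ ε × pow G (pow G b j) n ≈ ε
  [aⁱbʲ]ⁿ≈ε⇒factors≈ε {a} {b} {ρ} {x = x} i j n ⟨a⟩∩⟨b⟩≈1 a-order bʲ-acts x≈aⁱbʲ xⁿ≈ε =
    trivialIntersection-∙≈ε ⟨a⟩∩⟨b⟩≈1 a-order (i * geometricSum ρ n , ≈-refl) (n * j , sym (pow-* b n j))
    (begin
      pow G a (i * geometricSum ρ n) ∙ pow G (pow G b j) n  ≈⟨ pow-[aⁱh]ⁿ bʲ-acts i n ⟨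
      pow G (pow G a i ∙ pow G b j) n                        ≈⟨ pow-cong n x≈aⁱbʲ ⟨
      pow G x n                                              ≈⟨ xⁿ≈ε ⟩
      ε                                                      ∎)

  actsByPower⇒r≡1[p] : ∀ {p h a r} s → Prime p → HasOrder G a (p ^ suc s) →
    ActsByPower h a r → pow G h p ≈ ε → ∃ λ u → r ≡ 1 + u * p
  actsByPower⇒r≡1[p] {p} {r = r} s p-prime a-order h-acts hᵖ≈ε
    with q , r^p≡1+q*p^[1+s] ← pow≈self⇒≡1+q*n a-order (^-monoʳ-< p (prime>1 p-prime) (z<s {s}))
                                 (actsByPower-trivial (actsByPower-iterate h-acts p) hᵖ≈ε)
    = r^p≡1[p^[1+s]]⇒r≡1[p] p-prime s r q r^p≡1+q*p^[1+s]

  ∣⇒pow∈⟨pow⟩ : ∀ g {d k} → d ∣ k → InCyclic G (pow G g d) (pow G g k)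
  ∣⇒pow∈⟨pow⟩ g {d} (divides q refl) = q , pow-* g q d

  ≈∙⇒InProduct : ∀ {g h x u v} → x ≈ u ∙ v → InCyclic G g u → InCyclic G h v → InProduct G g h x
  ≈∙⇒InProduct x≈u∙v (i , u≈gⁱ) (j , v≈hʲ) = i , j , trans x≈u∙v (∙-cong u≈gⁱ v≈hʲ)

proposition2p3 : ∀ {c ℓ : Level} (G : Group c ℓ) (p s t : ℕ) (a b : Group.Carrier G) →
    Prime p → p ≢ 2 → 1 ≤ s → 1 ≤ t →
    HasOrder G a (p ^ s) → HasOrder G b (p ^ t) →
    (∀ g → InCyclic G a (Group._∙_ G (Group._∙_ G g a) (Group._⁻¹ G g))) →
    (∀ g → InProduct G a b g) →
    (∀ x → InCyclic G a x → InCyclic G b x → Group._≈_ G x (Group.ε G)) →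
    ∀ x → HasOrder G x p →
    InProduct G (pow G a (p ^ (s ∸ 1))) (pow G b (p ^ (t ∸ 1))) x
proposition2p3 G p (suc s) (suc t) a b p-prime p≢2 (s≤s z≤n) (s≤s z≤n)
               a-order b-order normal generated disjoint x x-order
  with i , j , x≈aⁱbʲ ← generated x
  with r , b-acts ← normal⇒actsByPower G (normal b)
  with bʲ-acts ← actsByPower-iterate G b-acts j
  with aⁱˢ≈ε , [bʲ]ᵖ≈ε ← [aⁱbʲ]ⁿ≈ε⇒factors≈ε G i j p disjoint a-order bʲ-acts x≈aⁱbʲ (proj₁ (proj₂ x-order))
  = ≈∙⇒InProduct G x≈aⁱbʲ (∣⇒pow∈⟨pow⟩ G a p^s∣i) (∣⇒pow∈⟨pow⟩ G b p^t∣j)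
  where
  open Group G
  instance _ = prime⇒nonZero p-prime
  p^s∣i : p ^ s ∣ i
  p^s∣i = p^[1+k]∣m*geometricSum⇒p^k∣m p-prime p≢2 (actsByPower⇒r≡1[p] G s p-prime a-order bʲ-acts [bʲ]ᵖ≈ε)
            s i (hasOrder⇒∣ G a-order aⁱˢ≈ε)
  p^t∣j : p ^ t ∣ j
  p^t∣j = *-cancelˡ-∣ p (hasOrder⇒∣ G b-order (trans (pow-* G b p j) [bʲ]ᵖ≈ε))
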